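{- Let $\mathcal{C}$ be a class of finite simple undirected graphs. Then $\mathcal{C}$ is both weakly sparse and strongly flip-flat if and only if $\mathcal{C}$ is uniformly almost-wide.
   Context: $\mathbb{N}$ denotes the positive integers. For a graph $G$ and $S\subseteq V(G)$, $G\setminus S$ is the subgraph induced by $V(G)\setminus S$. A set $B\subseteq V(G)$ is $r$-independent in $G$ if every two distinct vertices of $B$ are at distance strictly greater than $r$ in $G$. $K_{t,t}$ is the complete bipartite graph with $t$ vertices on each side. A class $\mathcal{C}$ is weakly sparse if there is $t\in\mathbb{N}$ such that no graph of $\mathcal{C}$ contains $K_{t,t}$ as a subgraph. A flip in $G$ is a pair $F=(A,B)$ of subsets of $V(G)$ (possibly intersecting or equal); $G\oplus F$ is the graph on $V(G)$ whose edge set is $E(G)\,\Delta\,((A\times B)\cup(B\times A))$ (i.e. adjacency between every vertex of $A$ and every other vertex of $B$ is complemented). For a set of flips $\mathcal{F}=\{F_1,\dots,F_k\}$, $G\oplus\mathcal{F}=G\oplus F_1\oplus\cdots\oplus F_k$. $\mathcal{C}$ is strongly flip-flat if there is an integer $s$ such that for every $r\in\mathbb{N}$ there is a function $N_r:\mathbb{N}\to\mathbb{N}$ such that for all $m\in\mathbb{N}$, all $G\in\mathcal{C}$ and all $A\subseteq V(G)$ with $|A|\ge N_r(m)$, there are a set of flips $\mathcal{F}$ with $|\mathcal{F}|\le s$ and $B\subseteq A$ with $|B|\ge m$ such that $B$ is $r$-independent in $G\oplus\mathcal{F}$. $\mathcal{C}$ is uniformly almost-wide if there is an integer $s$ such that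 for every $r\in\mathbb{N}$ there is a function $N_r:\mathbb{N}\to\mathbb{N}$ such that for all $m\in\mathbb{N}$, all $G\in\mathcal{C}$ and all $A\subseteq V(G)$ with $|A|\ge N_r(m)$, there are $S\subseteq V(G)$ with $|S|\le s$ and $B\subseteq A\setminus S$ with $|B|> m$ such that $B$ is $r$-independent in $G\setminus S$. -}

module Defs where

open import Data.Nat using (ℕ; zero; suc; _≤_; _<_)
open import Data.Bool using (Bool; true; false; _∧_; _∨_; _xor_; not)
open import Data.Fin using (Fin)
open import Data.Fin.Subset using (Subset; _∈_; _∉_; _⊆_; ∣_∣)
open import Data.Vec using (lookup)
open import Data.List using (List; length; foldl)
open import Data.Product using (Σ; ∃; ∃-syntax; _×_; _,_)
open import Relation.Nullary using (¬_; does)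
open import Relation.Binary.PropositionalEquality using (_≡_; _≢_)
open import Function.Definitions using (Injective)
import Data.Fin as F

record Graph : Set where
  field
    n      : ℕ
    adj    : Fin n → Fin n → Bool
    sym    : ∀ u v → adj u v ≡ adj v u
    irrefl : ∀ u → adj u u ≡ false
open Graph public

Class : Set₁
Class = Graph → Set

data Walk {n : ℕ} (E : Fin n → Fin n → Bool) : Fin n → Fin n → ℕ → Set where
  here : ∀ {u} → Walk E u u zero
  step : ∀ {u v w k} → E u v ≡ true → Walk E v w k → Walk E u w (suc k)

DistLe : {n : ℕ} → (Fin n → Fin n → Bool) → ℕ → Fin n → Fin n → Set
DistLe E r u v = ∃[ k ] (k ≤ r × Walk E u v k)

RIndep : {n : ℕ} → (Fin n → Fin n → Bool) → ℕ → Subset n → Set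
RIndep E r B = ∀ u v → u ∈ B → v ∈ B → u ≢ v → ¬ DistLe E r u v

-- Adjacency of G ∖ S: the induced subgraph on V(G) ∖ S (vertices of S are
-- kept only as isolated points, which does not affect distances between
-- vertices outside S).
deleteAdj : (G : Graph) → Subset (n G) → Fin (n G) → Fin (n G) → Bool
deleteAdj G S u v = adj G u v ∧ not (lookup S u) ∧ not (lookup S v)

ContainsKtt : ℕ → Graph → Set
ContainsKtt t G =
  Σ (Fin t → Fin (n G)) λ f → Σ (Fin t → Fin (n G)) λ g →
    Injective _≡_ _≡_ f × Injective _≡_ _≡_ g ×
    (∀ i j → f i ≢ g j) × (∀ i j → adj G (f i) (g j) ≡ true)

WeaklySparse : Class → Set
WeaklySparse C = ∃[ t ] (∀ G → C G → ¬ ContainsKtt t G)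

Flip : ℕ → Set
Flip n = Subset n × Subset n

flipAdj : {n : ℕ} → (Fin n → Fin n → Bool) → Flip n → Fin n → Fin n → Bool
flipAdj E (A , B) u v =
  E u v xor (not (does (u F.≟ v)) ∧
             ((lookup A u ∧ lookup B v) ∨ (lookup B u ∧ lookup A v)))

flipsAdj : (G : Graph) → List (Flip (n G)) → Fin (n G) → Fin (n G) → Bool
flipsAdj G Fs = foldl flipAdj (adj G) Fs

StronglyFlipFlat : Class → Set
StronglyFlipFlat C =
  ∃[ s ] ∀ (r : ℕ) → 1 ≤ r →
    Σ (ℕ → ℕ) λ N → ∀ (m : ℕ) → 1 ≤ m → ∀ G → C G → ∀ (A : Subset (n G)) → N m ≤ ∣ A ∣ →
      Σ (List (Flip (n G))) λ Fs → Σ (Subset (n G)) λ B → (length Fs ≤ s × B ⊆ A × m ≤ ∣ B ∣ × RIndep (flipsAdj G Fs) r B)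

UniformlyAlmostWide : Class → Set
UniformlyAlmostWide C =
  ∃[ s ] ∀ (r : ℕ) → 1 ≤ r →
    Σ (ℕ → ℕ) λ N → ∀ (m : ℕ) → 1 ≤ m → ∀ G → C G → ∀ (A : Subset (n G)) → N m ≤ ∣ A ∣ →
      Σ (Subset (n G)) λ S → Σ (Subset (n G)) λ B → (∣ S ∣ ≤ s × B ⊆ A × (∀ v → v ∈ B → v ∉ S) × m < ∣ B ∣ ×
                     RIndep (deleteAdj G S) r B)

-- Deleting a set S of vertices is simulated by the |S| flips ({x}, N(x)), x ∈ S, which
-- isolate S; hence uniform almost-wideness implies strong flip-flatness. It also implies weak
-- sparseness: in a K_{t,t} with t > s + N(1), any two left vertices surviving the deletion of
-- s vertices keep a common right neighbour, so they are at distance 2.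
--
-- Conversely, k flips split the vertices into at most 4^k types, and whether the adjacency of
-- two distinct vertices is complemented depends only on their types. In a K_{t,t}-free graph,
-- delete every type class of size < t² + t and, from each larger class, the vertices having at
-- most t non-neighbours in it; there are fewer than t of those, as otherwise the class would
-- contain the other side of a K_{t,t}. At most 4^k (t² + t) vertices are deleted. Let xz be an
-- edge between survivors whose adjacency is complemented by the flips. Then x has at least t
-- non-neighbours q in the class of z, and z at least t non-neighbours p in the class of x, and
-- in the flipped graph x q, p z and every non-edge q p become edges. Since these two sets
-- cannot be completely joined, x and z are at distance at most 3 in the flipped graph, so
-- 3r-independence after the flips yields r-independence after the deletion.

module Submission where

open import Defs renaming (sym to adj-sym)

open import Data.Bool using (Bool; true; false; not; _∧_; _∨_; _xor_)
import Data.Bool as Bool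
open import Data.Bool.Properties
  using (∧-zeroʳ; ∧-comm; ∨-comm; xor-assoc; xor-identityʳ; ∧-distribˡ-xor)
open import Data.Empty using (⊥-elim)
open import Data.Fin using (Fin; zero; suc; _≟_)
open import Data.Fin.Properties using (suc-injective; 0≢1+n; any?; ¬∀⟶∃¬)
open import Data.Fin.Subset
  using (Subset; inside; outside; _∈_; _∉_; _⊆_; ∣_∣; _∪_; _∩_; _─_; _-_; ⁅_⁆; ⋃; Nonempty)
open import Data.Fin.Subset.Properties
  using (_∈?_; nonempty?; Empty-unique; ∣⊥∣≡0; ∣⁅x⁆∣≡1; p⊆q⇒∣p∣≤∣q∣; p⊆p∪q; q⊆p∪q;
         x∈p∩q⁺; x∈p∩q⁻; x∈p∧x∉q⇒x∈p─q; p─q⊆p; x∈⁅x⁆; x≢y⇒x∉⁅y⁆; x∉⁅y⁆⇒x≢y;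
         x∈p∧x≢y⇒x∈p-y; x∈p⇒∣p-x∣<∣p∣)
open import Data.List
  using (List; []; _∷_; _++_; length; map; foldl; foldr; allFin; cartesianProductWith)
open import Data.List.Properties using (≡-dec; length-tabulate; length-map; length-++)
open import Data.List.Membership.Propositional using () renaming (_∈_ to _∈ₗ_)
open import Data.List.Membership.Propositional.Properties
  using (∈-allFin; ∈-map⁻; ∈-cartesianProductWith⁺)
open import Data.List.Relation.Unary.Any using (here; there)
open import Data.Nat using (ℕ; zero; suc; _+_; _*_; _^_; _≤_; _<_; _≤?_; z≤n; s≤s; s≤s⁻¹)
open import Data.Nat.Properties
  using (≤-refl; ≤-trans; ≤-reflexive; <⇒≤; <⇒≱; ≰⇒>; <-irrefl; n≤1+n; m≤m+n; m≤n+m;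
         +-comm; +-suc; *-suc; +-mono-≤; +-monoʳ-≤; +-cancelʳ-≤; *-monoʳ-≤; *-monoˡ-≤; ^-monoʳ-≤)
open import Data.Product using (Σ; ∃-syntax; _×_; _,_)
open import Data.Product.Properties using () renaming (≡-dec to ×-≡-dec)
open import Data.Vec using ([]; _∷_; lookup; tabulate; here; there)
open import Data.Vec.Properties using (lookup∘tabulate; lookup-replicate; []=⇒lookup; lookup⇒[]=)
import Data.Vec.Functional as Vector
open import Function.Base using (id)
open import Function.Bundles using (_⇔_; mk⇔)
open import Function.Definitions using (Injective)
open import Relation.Binary.Definitions using (DecidableEquality)
open import Relation.Binary.PropositionalEquality
  using (_≡_; _≢_; refl; sym; trans; cong; cong₂; subst; module ≡-Reasoning)
open import Relation.Nullary using (yes; no; does; ¬_; contradiction; _×-dec_)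
open import Relation.Nullary.Decidable using (dec-true; dec-false)
open import Relation.Unary using (Pred; Decidable)

private
  variable
    k : ℕ

∉⇒lookup≡false : ∀ {x : Fin k} {p : Subset k} → x ∉ p → lookup p x ≡ false
∉⇒lookup≡false {x = x} {p} x∉p with lookup p x in eq
... | true  = contradiction (lookup⇒[]= x p eq) x∉p
... | false = refl

not-lookup⇒∉ : ∀ {x : Fin k} {p : Subset k} → not (lookup p x) ≡ true → x ∉ p
not-lookup⇒∉ ¬x∈p x∈p with trans (cong not (sym ([]=⇒lookup x∈p))) ¬x∈p
... | ()

∈-tabulate⁺ : ∀ {f : Fin k → Bool} {x} → f x ≡ true → x ∈ tabulate f
∈-tabulate⁺ {f = f} {x} fx = lookup⇒[]= x (tabulate f) (trans (lookup∘tabulate f x) fx)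

∈-tabulate⁻ : ∀ {f : Fin k → Bool} {x} → x ∈ tabulate f → f x ≡ true
∈-tabulate⁻ {f = f} {x} x∈ = trans (sym (lookup∘tabulate f x)) ([]=⇒lookup x∈)

∉-tabulate⁻ : ∀ {f : Fin k → Bool} {x} → x ∉ tabulate f → f x ≡ false
∉-tabulate⁻ {f = f} {x} x∉ = trans (sym (lookup∘tabulate f x)) (∉⇒lookup≡false x∉)

select : ∀ {ℓ} {P : Pred (Fin k) ℓ} → Decidable P → Subset k
select P? = tabulate (λ x → does (P? x))

∈-select⁺ : ∀ {ℓ} {P : Pred (Fin k) ℓ} (P? : Decidable P) {x} → P x → x ∈ select P?
∈-select⁺ P? {x} px = ∈-tabulate⁺ (dec-true (P? x) px)

∈-select⁻ : ∀ {ℓ} {P : Pred (Fin k) ℓ} (P? : Decidable P) {x} → x ∈ select P? → P x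
∈-select⁻ P? {x} x∈ with P? x | ∈-tabulate⁻ {f = λ y → does (P? y)} x∈
... | yes px | _ = px

∣p∪q∣≤∣p∣+∣q∣ : ∀ (p q : Subset k) → ∣ p ∪ q ∣ ≤ ∣ p ∣ + ∣ q ∣
∣p∪q∣≤∣p∣+∣q∣ []            []            = z≤n
∣p∪q∣≤∣p∣+∣q∣ (inside  ∷ p) (inside  ∷ q) =
  s≤s (≤-trans (∣p∪q∣≤∣p∣+∣q∣ p q) (+-monoʳ-≤ ∣ p ∣ (n≤1+n ∣ q ∣)))
∣p∪q∣≤∣p∣+∣q∣ (inside  ∷ p) (outside ∷ q) = s≤s (∣p∪q∣≤∣p∣+∣q∣ p q)
∣p∪q∣≤∣p∣+∣q∣ (outside ∷ p) (inside  ∷ q) =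
  ≤-trans (s≤s (∣p∪q∣≤∣p∣+∣q∣ p q)) (≤-reflexive (sym (+-suc ∣ p ∣ ∣ q ∣)))
∣p∪q∣≤∣p∣+∣q∣ (outside ∷ p) (outside ∷ q) = ∣p∪q∣≤∣p∣+∣q∣ p q

p⊆[p─q]∪q : ∀ {p q : Subset k} → p ⊆ (p ─ q) ∪ q
p⊆[p─q]∪q {p = p} {q} {x} x∈p with x ∈? q
... | yes x∈q = q⊆p∪q (p ─ q) q x∈q
... | no  x∉q = p⊆p∪q q (x∈p∧x∉q⇒x∈p─q x∈p x∉q)

∣p∣≤∣p─q∣+∣q∣ : ∀ (p q : Subset k) → ∣ p ∣ ≤ ∣ p ─ q ∣ + ∣ q ∣
∣p∣≤∣p─q∣+∣q∣ p q = ≤-trans (p⊆q⇒∣p∣≤∣q∣ (p⊆[p─q]∪q {p = p} {q})) (∣p∪q∣≤∣p∣+∣q∣ (p ─ q) q)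

∣p∣≤1+∣p-x∣ : ∀ (p : Subset k) x → ∣ p ∣ ≤ suc ∣ p - x ∣
∣p∣≤1+∣p-x∣ p x = subst (λ c → ∣ p ∣ ≤ c) (trans (cong (∣ p - x ∣ +_) (∣⁅x⁆∣≡1 x)) (+-comm ∣ p - x ∣ 1))
  (∣p∣≤∣p─q∣+∣q∣ p ⁅ x ⁆)

∣p─q∣≥ : ∀ {a b} (p q : Subset k) → a + b ≤ ∣ p ∣ → ∣ q ∣ ≤ b → a ≤ ∣ p ─ q ∣
∣p─q∣≥ {a = a} {b} p q a+b≤∣p∣ ∣q∣≤b = +-cancelʳ-≤ b a ∣ p ─ q ∣
  (≤-trans a+b≤∣p∣ (≤-trans (∣p∣≤∣p─q∣+∣q∣ p q) (+-monoʳ-≤ ∣ p ─ q ∣ ∣q∣≤b)))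

x∈p─q⇒x∉q : ∀ (p q : Subset k) {x} → x ∈ p ─ q → x ∉ q
x∈p─q⇒x∉q (_ ∷ p) (outside ∷ q) (there x∈) (there x∈q) = x∈p─q⇒x∉q p q x∈ x∈q
x∈p─q⇒x∉q (_ ∷ p) (inside  ∷ q) (there x∈) (there x∈q) = x∈p─q⇒x∉q p q x∈ x∈q

∉p─q⇒∈q : ∀ {p q : Subset k} {x} → x ∈ p → x ∉ p ─ q → x ∈ q
∉p─q⇒∈q {q = q} {x} x∈p x∉p─q with x ∈? q
... | yes x∈q = x∈q
... | no  x∉q = contradiction (x∈p∧x∉q⇒x∈p─q x∈p x∉q) x∉p─q

∣p∣>0⇒Nonempty : ∀ {p : Subset k} → 0 < ∣ p ∣ → Nonempty p
∣p∣>0⇒Nonempty {k = k} {p = p} ∣p∣>0 with nonempty? p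
... | yes ne    = ne
... | no  empty = ⊥-elim (<-irrefl (sym (trans (cong ∣_∣ (Empty-unique empty)) (∣⊥∣≡0 k))) ∣p∣>0)

fresh-∷-injective : ∀ {t} {x : Fin k} {f : Fin t → Fin k} →
  (∀ i → f i ≢ x) → Injective _≡_ _≡_ f → Injective _≡_ _≡_ (x Vector.∷ f)
fresh-∷-injective fresh inj {zero}  {zero}  _ = refl
fresh-∷-injective fresh inj {zero}  {suc j} e = contradiction (sym e) (fresh j)
fresh-∷-injective fresh inj {suc i} {zero}  e = contradiction e (fresh i)
fresh-∷-injective fresh inj {suc i} {suc j} e = cong suc (inj e)

enumerate : ∀ t (p : Subset k) → t ≤ ∣ p ∣ →
  Σ (Fin t → Fin k) λ f → Injective _≡_ _≡_ f × (∀ i → f i ∈ p)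
enumerate zero    p _ = (λ ()) , (λ { {()} }) , (λ ())
enumerate (suc t) p t<∣p∣ with ∣p∣>0⇒Nonempty (≤-trans (s≤s z≤n) t<∣p∣)
... | x , x∈p with enumerate t (p - x) (s≤s⁻¹ (≤-trans t<∣p∣ (∣p∣≤1+∣p-x∣ p x)))
... | f , f-inj , f∈p-x = x Vector.∷ f , fresh-∷-injective fresh f-inj , member
  where
  fresh : ∀ i → f i ≢ x
  fresh i refl = x∈p─q⇒x∉q p ⁅ x ⁆ (f∈p-x i) (x∈⁅x⁆ x)
  member : ∀ i → (x Vector.∷ f) i ∈ p
  member zero    = x∈p
  member (suc i) = p─q⊆p p ⁅ x ⁆ (f∈p-x i)

injection⇒≤∣∣ : ∀ t {p : Subset k} (f : Fin t → Fin k) →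
  Injective _≡_ _≡_ f → (∀ i → f i ∈ p) → t ≤ ∣ p ∣
injection⇒≤∣∣ zero    f _   _  = z≤n
injection⇒≤∣∣ (suc t) {p} f inj f∈ =
  ≤-trans (s≤s (injection⇒≤∣∣ t (λ i → f (suc i)) (λ e → suc-injective (inj e)) f∈p-f0))
          (x∈p⇒∣p-x∣<∣p∣ (f∈ zero))
  where
  f∈p-f0 : ∀ i → f (suc i) ∈ p - f zero
  f∈p-f0 i = x∈p∧x≢y⇒x∈p-y (f∈ (suc i)) (λ e → 0≢1+n (inj (sym e)))

∈⋃-map⁺ : ∀ {a} {A : Set a} (f : A → Subset k) {xs y z} → y ∈ₗ xs → z ∈ f y → z ∈ ⋃ (map f xs)
∈⋃-map⁺ f {_ ∷ xs} (here refl) z∈ = p⊆p∪q (⋃ (map f xs)) z∈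
∈⋃-map⁺ f {x ∷ _}  (there y∈)  z∈ = q⊆p∪q (f x) _ (∈⋃-map⁺ f y∈ z∈)

∣⋃-map∣≤ : ∀ {a} {A : Set a} (f : A → Subset k) (xs : List A) {b} →
  (∀ x → ∣ f x ∣ ≤ b) → ∣ ⋃ (map f xs) ∣ ≤ length xs * b
∣⋃-map∣≤ {k = k} f []       _ = ≤-reflexive (∣⊥∣≡0 k)
∣⋃-map∣≤ f (x ∷ xs) bound =
  ≤-trans (∣p∪q∣≤∣p∣+∣q∣ (f x) _) (+-mono-≤ (bound x) (∣⋃-map∣≤ f xs bound))

∧-true⁻ : ∀ {a b} → a ∧ b ≡ true → a ≡ true × b ≡ true
∧-true⁻ {true} b≡true = refl , b≡true

_++ʷ_ : ∀ {E : Fin k → Fin k → Bool} {x y z a b} → Walk E x y a → Walk E y z b → Walk E x z (a + b)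
here       ++ʷ w′ = w′
step e w   ++ʷ w′ = step e (w ++ʷ w′)

walk-stretch : ∀ {E E′ : Fin k → Fin k → Bool} c →
  (∀ {x y} → E x y ≡ true → ∃[ a ] (a ≤ c × Walk E′ x y a)) →
  ∀ {x y j} → Walk E x y j → ∃[ a ] (a ≤ c * j × Walk E′ x y a)
walk-stretch c edge here = 0 , z≤n , here
walk-stretch c edge {j = suc j} (step e w) with edge e | walk-stretch c edge w
... | a , a≤c , w₁ | b , b≤cj , w₂ =
  a + b , ≤-trans (+-mono-≤ a≤c b≤cj) (≤-reflexive (sym (*-suc c j))) , w₁ ++ʷ w₂

RIndep-transfer : ∀ {E E′ : Fin k → Fin k → Bool} {r r′} {B B′ : Subset k} → B′ ⊆ B →
  (∀ {u v} → u ∈ B′ → DistLe E r u v → DistLe E′ r′ u v) → RIndep E′ r′ B → RIndep E r B′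
RIndep-transfer B′⊆B transfer indep u v u∈ v∈ u≢v dist =
  indep u v (B′⊆B u∈) (B′⊆B v∈) u≢v (transfer u∈ dist)

module _ (G : Graph) where

  nbhd : Fin (n G) → Subset (n G)
  nbhd x = tabulate (adj G x)

  adj⇒≢ : ∀ {u v} → adj G u v ≡ true → u ≢ v
  adj⇒≢ {u} uv refl with trans (sym uv) (irrefl G u)
  ... | ()

  deleteAdj-edge⁺ : ∀ {S u v} → adj G u v ≡ true → u ∉ S → v ∉ S → deleteAdj G S u v ≡ true
  deleteAdj-edge⁺ uv u∉S v∉S rewrite uv | ∉⇒lookup≡false u∉S | ∉⇒lookup≡false v∉S = refl

  deleteAdj-edge⁻ : ∀ {S u v} → deleteAdj G S u v ≡ true → adj G u v ≡ true × u ∉ S × v ∉ S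
  deleteAdj-edge⁻ {S} {u} {v} e with ∧-true⁻ {adj G u v} e
  ... | uv , u∉S∧v∉S with ∧-true⁻ {not (lookup S u)} u∉S∧v∉S
  ... | u∉S , v∉S = uv , not-lookup⇒∉ u∉S , not-lookup⇒∉ v∉S

  complete⇒Ktt : ∀ {t} (f g : Fin t → Fin (n G)) → Injective _≡_ _≡_ f → Injective _≡_ _≡_ g →
    (∀ i j → adj G (f i) (g j) ≡ true) → ContainsKtt t G
  complete⇒Ktt f g f-inj g-inj complete =
    f , g , f-inj , g-inj , (λ i j → adj⇒≢ (complete i j)) , complete

  completeSets⇒Ktt : ∀ {t} {X Y : Subset (n G)} → t ≤ ∣ X ∣ → t ≤ ∣ Y ∣ →
    (∀ {x y} → x ∈ X → y ∈ Y → adj G x y ≡ true) → ContainsKtt t G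
  completeSets⇒Ktt {t} {X} {Y} t≤X t≤Y complete with enumerate t X t≤X | enumerate t Y t≤Y
  ... | f , f-inj , f∈X | g , g-inj , g∈Y =
    complete⇒Ktt f g f-inj g-inj (λ i j → complete (f∈X i) (g∈Y j))

  missedBy : ∀ {t} → Subset (n G) → (Fin t → Fin (n G)) → Subset (n G)
  missedBy {t} Y f = ⋃ (map (λ i → Y ─ nbhd (f i)) (allFin t))

  ∈Y─missedBy⇒adj : ∀ {t} {Y : Subset (n G)} (f : Fin t → Fin (n G)) {y} →
    y ∈ Y ─ missedBy Y f → ∀ i → adj G (f i) y ≡ true
  ∈Y─missedBy⇒adj {Y = Y} f y∈ i = ∈-tabulate⁻ (∉p─q⇒∈q (p─q⊆p Y _ y∈) λ y∈Y─N →
    x∈p─q⇒x∉q Y _ y∈ (∈⋃-map⁺ (λ i → Y ─ nbhd (f i)) (∈-allFin i) y∈Y─N))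

  ∣Y─missedBy∣≥t : ∀ {t} {Y : Subset (n G)} (f : Fin t → Fin (n G)) →
    (∀ i → ∣ Y ─ nbhd (f i) ∣ ≤ t) → suc t * t ≤ ∣ Y ∣ → t ≤ ∣ Y ─ missedBy Y f ∣
  ∣Y─missedBy∣≥t {t} {Y} f sparse big = ∣p─q∣≥ Y (missedBy Y f) big
    (subst (λ c → ∣ missedBy Y f ∣ ≤ c * t) (length-tabulate {n = t} id)
      (∣⋃-map∣≤ (λ i → Y ─ nbhd (f i)) (allFin t) sparse))

  denseSets⇒Ktt : ∀ {t} {X Y : Subset (n G)} → t ≤ ∣ X ∣ → suc t * t ≤ ∣ Y ∣ →
    (∀ {x} → x ∈ X → ∣ Y ─ nbhd x ∣ ≤ t) → ContainsKtt t G
  denseSets⇒Ktt {t} {X} {Y} t≤X big sparse with enumerate t X t≤X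
  ... | f , f-inj , f∈X
    with enumerate t (Y ─ missedBy Y f) (∣Y─missedBy∣≥t {Y = Y} f (λ i → sparse (f∈X i)) big)
  ... | g , g-inj , g∈ =
    complete⇒Ktt f g f-inj g-inj (λ i j → ∈Y─missedBy⇒adj {Y = Y} f (g∈ j) i)

FlipType : Set
FlipType = List (Bool × Bool)

_≟ₜ_ : DecidableEquality FlipType
_≟ₜ_ = ≡-dec (×-≡-dec Bool._≟_ Bool._≟_)

flipType : List (Flip k) → Fin k → FlipType
flipType Fs u = map (λ (A , B) → lookup A u , lookup B u) Fs

flipped : FlipType → FlipType → Bool
flipped ((a , b) ∷ τ) ((c , d) ∷ σ) = ((a ∧ d) ∨ (b ∧ c)) xor flipped τ σ
flipped _             _             = false

flipped-sym : ∀ τ σ → flipped τ σ ≡ flipped σ τ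
flipped-sym []            []            = refl
flipped-sym []            (_ ∷ _)       = refl
flipped-sym (_ ∷ _)       []            = refl
flipped-sym ((a , b) ∷ τ) ((c , d) ∷ σ) =
  cong₂ _xor_ (trans (∨-comm (a ∧ d) (b ∧ c)) (cong₂ _∨_ (∧-comm b c) (∧-comm a d))) (flipped-sym τ σ)

foldl-flipAdj : ∀ (E : Fin k → Fin k → Bool) Fs u v →
  foldl flipAdj E Fs u v ≡ E u v xor (not (does (u ≟ v)) ∧ flipped (flipType Fs u) (flipType Fs v))
foldl-flipAdj E [] u v = sym (trans (cong (E u v xor_) (∧-zeroʳ _)) (xor-identityʳ (E u v)))
foldl-flipAdj E ((A , B) ∷ Fs) u v = begin
  foldl flipAdj (flipAdj E (A , B)) Fs u v ≡⟨ foldl-flipAdj (flipAdj E (A , B)) Fs u v ⟩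
  (E u v xor (u≢v ∧ h)) xor (u≢v ∧ φ)     ≡⟨ xor-assoc (E u v) (u≢v ∧ h) (u≢v ∧ φ) ⟩
  E u v xor ((u≢v ∧ h) xor (u≢v ∧ φ))     ≡⟨ cong (E u v xor_) (sym (∧-distribˡ-xor u≢v h φ)) ⟩
  E u v xor (u≢v ∧ (h xor φ))             ∎
  where
  open ≡-Reasoning
  u≢v = not (does (u ≟ v))
  h   = (lookup A u ∧ lookup B v) ∨ (lookup B u ∧ lookup A v)
  φ   = flipped (flipType Fs u) (flipType Fs v)

boolPairs : List (Bool × Bool)
boolPairs = (false , false) ∷ (false , true) ∷ (true , false) ∷ (true , true) ∷ []

∈-boolPairs : ∀ p → p ∈ₗ boolPairs
∈-boolPairs (false , false) = here refl
∈-boolPairs (false , true)  = there (here refl)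
∈-boolPairs (true  , false) = there (there (here refl))
∈-boolPairs (true  , true)  = there (there (there (here refl)))

flipTypes : ℕ → List FlipType
flipTypes zero    = [] ∷ []
flipTypes (suc m) = cartesianProductWith _∷_ boolPairs (flipTypes m)

length-cartesianProductWith : ∀ {a b c} {A : Set a} {B : Set b} {C : Set c} (f : A → B → C) xs ys →
  length (cartesianProductWith f xs ys) ≡ length xs * length ys
length-cartesianProductWith f []       ys = refl
length-cartesianProductWith f (x ∷ xs) ys = begin
  length (map (f x) ys ++ cartesianProductWith f xs ys)      ≡⟨ length-++ (map (f x) ys) ⟩
  length (map (f x) ys) + length (cartesianProductWith f xs ys)
    ≡⟨ cong₂ _+_ (length-map (f x) ys) (length-cartesianProductWith f xs ys) ⟩
  length ys + length xs * length ys                           ∎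
  where open ≡-Reasoning

length-flipTypes : ∀ m → length (flipTypes m) ≡ 4 ^ m
length-flipTypes zero    = refl
length-flipTypes (suc m) =
  trans (length-cartesianProductWith _∷_ boolPairs (flipTypes m)) (cong (4 *_) (length-flipTypes m))

flipType∈flipTypes : ∀ (Fs : List (Flip k)) u → flipType Fs u ∈ₗ flipTypes (length Fs)
flipType∈flipTypes []       u = here refl
flipType∈flipTypes (F ∷ Fs) u =
  ∈-cartesianProductWith⁺ _∷_ (∈-boolPairs _) (flipType∈flipTypes Fs u)

members : Subset k → List (Fin k)
members []            = []
members (inside  ∷ p) = zero ∷ map suc (members p)
members (outside ∷ p) = map suc (members p)

length-members : ∀ (p : Subset k) → length (members p) ≡ ∣ p ∣
length-members []            = refl
length-members (inside  ∷ p) = cong suc (trans (length-map suc (members p)) (length-members p))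
length-members (outside ∷ p) = trans (length-map suc (members p)) (length-members p)

∈-members⁻ : ∀ {p : Subset k} {x} → x ∈ₗ members p → x ∈ p
∈-members⁻ {p = inside  ∷ p} (here refl) = here
∈-members⁻ {p = inside  ∷ p} (there x∈) with ∈-map⁻ suc x∈
... | _ , y∈ , refl = there (∈-members⁻ y∈)
∈-members⁻ {p = outside ∷ p} x∈ with ∈-map⁻ suc x∈
... | _ , y∈ , refl = there (∈-members⁻ y∈)

occursOddly : Fin k → List (Fin k) → Bool
occursOddly v = foldr (λ x b → lookup ⁅ x ⁆ v xor b) false

occursOddly-suc-map-suc : ∀ v (xs : List (Fin k)) →
  occursOddly (suc v) (map suc xs) ≡ occursOddly v xs
occursOddly-suc-map-suc v []       = refl
occursOddly-suc-map-suc v (x ∷ xs) = cong (lookup ⁅ x ⁆ v xor_) (occursOddly-suc-map-suc v xs)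

occursOddly-zero-map-suc : ∀ (xs : List (Fin k)) → occursOddly zero (map suc xs) ≡ false
occursOddly-zero-map-suc []       = refl
occursOddly-zero-map-suc (x ∷ xs) = occursOddly-zero-map-suc xs

occursOddly-members : ∀ (p : Subset k) v → occursOddly v (members p) ≡ lookup p v
occursOddly-members (inside  ∷ p) zero    = cong not (occursOddly-zero-map-suc (members p))
occursOddly-members (inside  ∷ p) (suc v) =
  cong₂ _xor_ (lookup-replicate v outside) (trans (occursOddly-suc-map-suc v (members p)) (occursOddly-members p v))
occursOddly-members (outside ∷ p) zero    = occursOddly-zero-map-suc (members p)
occursOddly-members (outside ∷ p) (suc v) =
  trans (occursOddly-suc-map-suc v (members p)) (occursOddly-members p v)

xor-∧ : ∀ a b → a xor (a ∧ b) ≡ a ∧ not b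
xor-∧ true  b = refl
xor-∧ false b = refl

module _ (G : Graph) where

  isolate : Fin (n G) → Flip (n G)
  isolate x = ⁅ x ⁆ , nbhd G x

  isolate-pair : ∀ {u v x} → u ≢ x →
    (lookup ⁅ x ⁆ u ∧ lookup (nbhd G x) v) ∨ (lookup (nbhd G x) u ∧ lookup ⁅ x ⁆ v) ≡
    adj G u v ∧ lookup ⁅ x ⁆ v
  isolate-pair {u} {v} {x} u≢x rewrite ∉⇒lookup≡false (x≢y⇒x∉⁅y⁆ u≢x) | lookup∘tabulate (adj G x) u
    with v ≟ x
  ... | yes refl = cong (_∧ lookup ⁅ v ⁆ v) (adj-sym G v u)
  ... | no  v≢x rewrite ∉⇒lookup≡false (x≢y⇒x∉⁅y⁆ v≢x) = trans (∧-zeroʳ _) (sym (∧-zeroʳ _))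

  flipped-isolate : ∀ {u v} xs → (∀ {x} → x ∈ₗ xs → u ≢ x) →
    flipped (flipType (map isolate xs) u) (flipType (map isolate xs) v) ≡ adj G u v ∧ occursOddly v xs
  flipped-isolate []       _     = sym (∧-zeroʳ _)
  flipped-isolate {u} {v} (x ∷ xs) u∉xs =
    trans (cong₂ _xor_ (isolate-pair (u∉xs (here refl))) (flipped-isolate xs (λ x∈ → u∉xs (there x∈))))
          (sym (∧-distribˡ-xor (adj G u v) (lookup ⁅ x ⁆ v) (occursOddly v xs)))

  flipsAdj-isolate : ∀ {S u} v → u ∉ S →
    flipsAdj G (map isolate (members S)) u v ≡ adj G u v ∧ not (lookup S v)
  flipsAdj-isolate {S} {u} v u∉S
    rewrite foldl-flipAdj (adj G) (map isolate (members S)) u v with u ≟ v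
  ... | yes refl rewrite irrefl G u = refl
  ... | no  _    = begin
    adj G u v xor flipped (flipType Fs u) (flipType Fs v)
      ≡⟨ cong (adj G u v xor_) (flipped-isolate (members S) u∉) ⟩
    adj G u v xor (adj G u v ∧ occursOddly v (members S))
      ≡⟨ cong (λ b → adj G u v xor (adj G u v ∧ b)) (occursOddly-members S v) ⟩
    adj G u v xor (adj G u v ∧ lookup S v)
      ≡⟨ xor-∧ (adj G u v) (lookup S v) ⟩
    adj G u v ∧ not (lookup S v)
      ∎
    where
    open ≡-Reasoning
    Fs = map isolate (members S)
    u∉ : ∀ {x} → x ∈ₗ members S → u ≢ x
    u∉ x∈ refl = u∉S (∈-members⁻ x∈)

  isolated-walk⇒deleted-walk : ∀ {S u v j} → u ∉ S →
    Walk (flipsAdj G (map isolate (members S))) u v j → Walk (deleteAdj G S) u v j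
  isolated-walk⇒deleted-walk u∉S here = here
  isolated-walk⇒deleted-walk {S} u∉S (step {v = z} e w)
    with ∧-true⁻ (trans (sym (flipsAdj-isolate z u∉S)) e)
  ... | uz , z∉S = step (deleteAdj-edge⁺ G uz u∉S (not-lookup⇒∉ z∉S))
                        (isolated-walk⇒deleted-walk {S} (not-lookup⇒∉ z∉S) w)

deletion⇒flips : (G : Graph) (S : Subset (n G)) →
  Σ (List (Flip (n G))) λ Fs → length Fs ≡ ∣ S ∣ ×
    (∀ {r u v} → u ∉ S → DistLe (flipsAdj G Fs) r u v → DistLe (deleteAdj G S) r u v)
deletion⇒flips G S =
  map (isolate G) (members S) ,
  trans (length-map (isolate G) (members S)) (length-members S) ,
  λ { u∉S (j , j≤r , w) → j , j≤r , isolated-walk⇒deleted-walk G u∉S w }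

uaw⇒sff : ∀ {C} → UniformlyAlmostWide C → StronglyFlipFlat C
uaw⇒sff (s , wide) = s , λ r r≥1 → let (N , wide-r) = wide r r≥1 in N , λ m m≥1 G G∈C A big →
  let (S , B , ∣S∣≤s , B⊆A , B-avoids-S , m<∣B∣ , B-indep) = wide-r m m≥1 G G∈C A big
      (Fs , ∣Fs∣≡∣S∣ , flip-dist⇒deletion-dist) = deletion⇒flips G S
  in Fs , B , subst (_≤ s) (sym ∣Fs∣≡∣S∣) ∣S∣≤s , B⊆A , <⇒≤ m<∣B∣ ,
     RIndep-transfer (λ u∈ → u∈) (λ u∈ → flip-dist⇒deletion-dist (B-avoids-S _ u∈)) B-indep

image : ∀ {t} → (Fin t → Fin k) → Subset k
image f = select (λ y → any? (λ i → f i ≟ y))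

∣image∣≥ : ∀ {t} (f : Fin t → Fin k) → Injective _≡_ _≡_ f → t ≤ ∣ image f ∣
∣image∣≥ {t = t} f f-inj =
  injection⇒≤∣∣ t f f-inj (λ i → ∈-select⁺ (λ y → any? (λ i → f i ≟ y)) (i , refl))

Ktt-side-2-close-after-deletion : ∀ {t} (G : Graph) (f g : Fin t → Fin (n G)) →
  Injective _≡_ _≡_ g → (∀ i j → adj G (f i) (g j) ≡ true) →
  ∀ {S u v} → ∣ S ∣ < t → u ∈ image f → v ∈ image f → u ∉ S → v ∉ S → DistLe (deleteAdj G S) 2 u v
Ktt-side-2-close-after-deletion {t} G f g g-inj complete {S} {u} {v} ∣S∣<t u∈ v∈ u∉S v∉S
  with ¬∀⟶∃¬ t (λ j → g j ∈ S) (λ j → g j ∈? S) (λ all∈S → <⇒≱ ∣S∣<t (injection⇒≤∣∣ t g g-inj all∈S))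
... | j , gj∉S = 2 , ≤-refl , step (to-gj u∈ u∉S) (step (from-gj v∈ v∉S) here)
  where
  adj-gj : ∀ {w} → w ∈ image f → adj G w (g j) ≡ true
  adj-gj w∈ with ∈-select⁻ (λ y → any? (λ i → f i ≟ y)) w∈
  ... | i , refl = complete i j
  to-gj : ∀ {w} → w ∈ image f → w ∉ S → deleteAdj G S w (g j) ≡ true
  to-gj w∈ w∉S = deleteAdj-edge⁺ G (adj-gj w∈) w∉S gj∉S
  from-gj : ∀ {w} → w ∈ image f → w ∉ S → deleteAdj G S (g j) w ≡ true
  from-gj {w} w∈ w∉S = deleteAdj-edge⁺ G (trans (adj-sym G (g j) w) (adj-gj w∈)) gj∉S w∉S

uaw⇒ws : ∀ {C} → UniformlyAlmostWide C → WeaklySparse C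
uaw⇒ws {C} (s , wide) with wide 2 (s≤s z≤n)
... | N , wide-2 = suc s + N 1 , no-Ktt
  where
  no-Ktt : ∀ G → C G → ¬ ContainsKtt (suc s + N 1) G
  no-Ktt G G∈C (f , g , f-inj , g-inj , _ , complete)
    with wide-2 1 (s≤s z≤n) G G∈C (image f) (≤-trans (m≤n+m (N 1) (suc s)) (∣image∣≥ f f-inj))
  ... | S , B , ∣S∣≤s , B⊆image , B-avoids-S , 1<∣B∣ , B-indep with enumerate 2 B 1<∣B∣
  ... | b , b-inj , b∈B =
    B-indep (b zero) (b (suc zero)) (b∈B zero) (b∈B (suc zero)) (λ e → 0≢1+n (b-inj e))
      (Ktt-side-2-close-after-deletion G f g g-inj complete (s≤s (≤-trans ∣S∣≤s (m≤m+n s (N 1))))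
        (B⊆image (b∈B zero)) (B⊆image (b∈B (suc zero))) (B-avoids-S _ (b∈B zero)) (B-avoids-S _ (b∈B (suc zero))))

module FlipsToDeletion {t} (G : Graph) (no-Ktt : ¬ ContainsKtt t G) (Fs : List (Flip (n G))) where

  H : Fin (n G) → Fin (n G) → Bool
  H = flipsAdj G Fs

  ty : Fin (n G) → FlipType
  ty = flipType Fs

  class : FlipType → Subset (n G)
  class τ = select (λ x → ty x ≟ₜ τ)

  close : FlipType → Subset (n G)
  close τ = select (λ x → ∣ class τ ─ nbhd G x ∣ ≤? t)

  deleted : FlipType → Subset (n G)
  deleted τ with suc t * t ≤? ∣ class τ ∣
  ... | yes _ = close τ
  ... | no  _ = class τ

  S : Subset (n G)
  S = ⋃ (map deleted (flipTypes (length Fs)))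

  ∣close∣<t : ∀ τ → suc t * t ≤ ∣ class τ ∣ → ∣ close τ ∣ < t
  ∣close∣<t τ big = ≰⇒> λ t≤∣close∣ →
    no-Ktt (denseSets⇒Ktt G {Y = class τ} t≤∣close∣ big (∈-select⁻ (λ x → ∣ class τ ─ nbhd G x ∣ ≤? t)))

  ∣deleted∣≤ : ∀ τ → ∣ deleted τ ∣ ≤ suc t * t
  ∣deleted∣≤ τ with suc t * t ≤? ∣ class τ ∣
  ... | yes big   = ≤-trans (<⇒≤ (∣close∣<t τ big)) (m≤m+n t (t * t))
  ... | no  small = <⇒≤ (≰⇒> small)

  ∣S∣≤ : ∣ S ∣ ≤ 4 ^ length Fs * (suc t * t)
  ∣S∣≤ = subst (λ c → ∣ S ∣ ≤ c * (suc t * t)) (length-flipTypes (length Fs))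
    (∣⋃-map∣≤ deleted (flipTypes (length Fs)) ∣deleted∣≤)

  far-from-undeleted-class : ∀ {x y τ} → x ∉ deleted τ → y ∉ deleted τ → y ∈ class τ →
    t < ∣ class τ ─ nbhd G x ∣
  far-from-undeleted-class {x} {τ = τ} x∉ y∉ y∈ with suc t * t ≤? ∣ class τ ∣
  ... | yes _ = ≰⇒> λ ≤t → x∉ (∈-select⁺ (λ x → ∣ class τ ─ nbhd G x ∣ ≤? t) ≤t)
  ... | no  _ = contradiction y∈ y∉

  nonNbrs : FlipType → Fin (n G) → Subset (n G)
  nonNbrs τ x = class τ ─ nbhd G x - x

  ∣nonNbrs∣≥t : ∀ {x y} → x ∉ S → y ∉ S → t ≤ ∣ nonNbrs (ty y) x ∣
  ∣nonNbrs∣≥t {x} {y} x∉S y∉S =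
    s≤s⁻¹ (≤-trans (far-from-undeleted-class (∉deleted x∉S) (∉deleted y∉S) y∈class)
                   (∣p∣≤1+∣p-x∣ (class (ty y) ─ nbhd G x) x))
    where
    ∉deleted : ∀ {w} → w ∉ S → w ∉ deleted (ty y)
    ∉deleted w∉S w∈ = w∉S (∈⋃-map⁺ deleted (flipType∈flipTypes Fs y) w∈)
    y∈class : y ∈ class (ty y)
    y∈class = ∈-select⁺ (λ w → ty w ≟ₜ ty y) refl

  ∈nonNbrs⁻ : ∀ {τ x y} → y ∈ nonNbrs τ x → ty y ≡ τ × adj G x y ≡ false × y ≢ x
  ∈nonNbrs⁻ {τ} {x} {y} y∈ =
    ∈-select⁻ (λ w → ty w ≟ₜ τ) (p─q⊆p (class τ) _ y∈p) ,
    ∉-tabulate⁻ (x∈p─q⇒x∉q (class τ) (nbhd G x) y∈p) ,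
    x∉⁅y⁆⇒x≢y (x∈p─q⇒x∉q _ ⁅ x ⁆ y∈)
    where
    y∈p : y ∈ class τ ─ nbhd G x
    y∈p = p─q⊆p _ ⁅ x ⁆ y∈

  H-flipped : ∀ {u v} → u ≢ v → H u v ≡ adj G u v xor flipped (ty u) (ty v)
  H-flipped {u} {v} u≢v = trans (foldl-flipAdj (adj G) Fs u v)
    (cong (λ b → adj G u v xor (not b ∧ flipped (ty u) (ty v))) (dec-false (u ≟ v) u≢v))

  flipped-nonadjacent⇒H : ∀ {u v} → u ≢ v → adj G u v ≡ false → flipped (ty u) (ty v) ≡ true →
    H u v ≡ true
  flipped-nonadjacent⇒H u≢v nonadj φ = trans (H-flipped u≢v) (cong₂ _xor_ nonadj φ)

  module FlippedEdge {x z} (x∉S : x ∉ S) (z∉S : z ∉ S) (φ : flipped (ty x) (ty z) ≡ true) where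

    Q P : Subset (n G)
    Q = nonNbrs (ty z) x
    P = nonNbrs (ty x) z

    x→Q : ∀ {q} → q ∈ Q → H x q ≡ true
    x→Q q∈ with ∈nonNbrs⁻ q∈
    ... | ty-q , nonadj , q≢x = flipped-nonadjacent⇒H (λ e → q≢x (sym e)) nonadj
                                  (trans (cong (flipped (ty x)) ty-q) φ)

    P→z : ∀ {p} → p ∈ P → H p z ≡ true
    P→z {p} p∈ with ∈nonNbrs⁻ p∈
    ... | ty-p , nonadj , p≢z = flipped-nonadjacent⇒H p≢z (trans (adj-sym G p z) nonadj)
                                  (trans (cong (λ σ → flipped σ (ty z)) ty-p) φ)

    Q→P : ∀ {q p} → q ∈ Q → p ∈ P → q ≢ p → adj G q p ≡ false → H q p ≡ true
    Q→P q∈ p∈ q≢p nonadj with ∈nonNbrs⁻ q∈ | ∈nonNbrs⁻ p∈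
    ... | ty-q , _ | ty-p , _ = flipped-nonadjacent⇒H q≢p nonadj
      (trans (cong₂ flipped ty-q ty-p) (trans (flipped-sym (ty z) (ty x)) φ))

    short-walk : ∃[ a ] (a ≤ 3 × Walk H x z a)
    short-walk with nonempty? (Q ∩ P)
    ... | yes (y , y∈Q∩P) with x∈p∩q⁻ Q P y∈Q∩P
    ...   | y∈Q , y∈P = 2 , s≤s (s≤s z≤n) , step (x→Q y∈Q) (step (P→z y∈P) here)
    short-walk | no Q∩P-empty with any? (λ q → q ∈? Q ×-dec nonempty? (P ─ nbhd G q))
    ... | yes (q , q∈Q , p , p∈P─Nq) =
      3 , ≤-refl , step (x→Q q∈Q) (step (Q→P q∈Q p∈P q≢p qp-nonadjacent) (step (P→z p∈P) here))
      where
      qp-nonadjacent : adj G q p ≡ false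
      qp-nonadjacent = ∉-tabulate⁻ (x∈p─q⇒x∉q P _ p∈P─Nq)
      p∈P : p ∈ P
      p∈P = p─q⊆p P _ p∈P─Nq
      q≢p : q ≢ p
      q≢p refl = Q∩P-empty (q , x∈p∩q⁺ (q∈Q , p∈P))
    ... | no no-nonadjacent-pair =
      ⊥-elim (no-Ktt (completeSets⇒Ktt G (∣nonNbrs∣≥t x∉S z∉S) (∣nonNbrs∣≥t z∉S x∉S) complete))
      where
      complete : ∀ {q p} → q ∈ Q → p ∈ P → adj G q p ≡ true
      complete {q} {p} q∈Q p∈P =
        ∈-tabulate⁻ (∉p─q⇒∈q p∈P λ p∈P─Nq → no-nonadjacent-pair (q , q∈Q , p , p∈P─Nq))

  edge⇒short-walk : ∀ {x z} → deleteAdj G S x z ≡ true → ∃[ a ] (a ≤ 3 × Walk H x z a)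
  edge⇒short-walk {x} {z} e with deleteAdj-edge⁻ G e
  ... | xz , x∉S , z∉S with flipped (ty x) (ty z) in φ
  ... | false = 1 , s≤s z≤n , step (trans (H-flipped (adj⇒≢ G xz)) (cong₂ _xor_ xz φ)) here
  ... | true  = FlippedEdge.short-walk x∉S z∉S φ

flips⇒deletion : ∀ {t} (G : Graph) → ¬ ContainsKtt t G → (Fs : List (Flip (n G))) →
  Σ (Subset (n G)) λ S → ∣ S ∣ ≤ 4 ^ length Fs * (suc t * t) ×
    (∀ {r u v} → DistLe (deleteAdj G S) r u v → DistLe (flipsAdj G Fs) (3 * r) u v)
flips⇒deletion G no-Ktt Fs = S , ∣S∣≤ , λ (j , j≤r , w) →
  let (a , a≤3j , w′) = walk-stretch 3 edge⇒short-walk w in a , ≤-trans a≤3j (*-monoʳ-≤ 3 j≤r) , w′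
  where open FlipsToDeletion G no-Ktt Fs

sparse∧sff⇒uaw : ∀ {C} → WeaklySparse C × StronglyFlipFlat C → UniformlyAlmostWide C
sparse∧sff⇒uaw ((t , no-Ktt) , (s , flat)) = bound , λ r r≥1 →
  let (N , flat-3r) = flat (3 * r) (≤-trans r≥1 (m≤m+n r (2 * r))) in
  (λ m → N (suc m + bound)) , λ m _ G G∈C A big →
  let (Fs , B , ∣Fs∣≤s , B⊆A , ∣B∣≥ , B-indep) = flat-3r (suc m + bound) (s≤s z≤n) G G∈C A big
      (S , ∣S∣≤ , deletion-dist⇒flip-dist) = flips⇒deletion G (no-Ktt G G∈C) Fs
      ∣S∣≤bound = ≤-trans ∣S∣≤ (*-monoˡ-≤ (suc t * t) (^-monoʳ-≤ 4 ∣Fs∣≤s))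
  in S , B ─ S , ∣S∣≤bound , (λ v∈ → B⊆A (p─q⊆p B S v∈)) , (λ v v∈ → x∈p─q⇒x∉q B S v∈) ,
     ∣p─q∣≥ B S ∣B∣≥ ∣S∣≤bound , RIndep-transfer (p─q⊆p B S) (λ _ → deletion-dist⇒flip-dist) B-indep
  where
  bound : ℕ
  bound = 4 ^ s * (suc t * t)

mainTheorem1 : (C : Class) → (WeaklySparse C × StronglyFlipFlat C) ⇔ UniformlyAlmostWide C
mainTheorem1 C = mk⇔ sparse∧sff⇒uaw (λ wide → uaw⇒ws wide , uaw⇒sff wide)
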